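{- The functor $G$ from the category $S_\chi$ to $\mathit{Rel}$ is faithful ($S_\chi$ Coherence).
   Context: The category $S_\chi$ has as objects the finite ordinals $n$. Its primitive arrow terms are $\mathbf{1}_n : n \vdash n$, $\varepsilon_n : n+1 \vdash n$ and $\chi_n : n+2 \vdash n+2$ for $n \ge 0$. Arrow terms are closed under composition and under an operation $\Box$ sending $f : n \vdash m$ to $\Box f : n+1 \vdash m+1$. Arrows are equivalence classes of arrow terms modulo the smallest equivalence relation that relates only terms of the same type, is a congruence for $\circ$ and $\Box$, and contains all instances of the following equations (for $f : n \vdash m$ and composable $g, h$): - $f \circ \mathbf{1}_n = \mathbf{1}_m \circ f = f$; - $h \circ (g \circ f) = (h \circ g) \circ f$; - $\Box\mathbf{1}_n = \mathbf{1}_{n+1}$; - $\Box(g \circ f) = \Box g \circ \Box f$; - $\varepsilon_m \circ \Box f = f \circ \varepsilon_n$; - $\Box\Box f \circ \chi_n = \chi_m \circ \Box\Box f$; - $\chi_n \circ \chi_n = \mathbf{1}_{n+2}$; - $\chi_{n+1} \circ \Box\chi_n \circ \chi_{n+1} = \Box\chi_n \circ \chi_{n+1} \circ \Box\chi_n$; - $\varepsilon_{n+1} \circ \chi_n = \Box\varepsilon_n$. $\mathit{Rel}$ is the category whose objects are the finite ordinals and whose arrows $n \to m$ are relations $R \subseteq n \times m$, with relational composition. The functor $G$ is the identity on objects. On arrows: - $G\mathbf{1}_n$ is the identity relation; - $G\varepsilon_0 = \emptyset$, and $G\varepsilon_n = \{(i,i) : i < n\}$; - $G\chi_n = \{(i,i)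 : i < n\} \cup \{(n,n+1), (n+1,n)\}$; - $G(g \circ f) = Gg \circ Gf$; - for $f : n \vdash m$, $G\Box f = Gf \cup \{(n,m)\}$. -}

module Defs where

open import Data.Nat using (ℕ; zero; suc; _+_; _≡ᵇ_; _<ᵇ_)
import Data.Fin as Fin
open import Data.Fin using (Fin; toℕ; fromℕ; inject₁)
open import Data.Maybe using (Maybe; just; nothing)
import Data.Maybe
open import Data.Bool using (Bool; true; false; _∧_; _∨_)
open import Relation.Binary.PropositionalEquality using (_≡_)

infixr 9 _∘_

data Term : ℕ → ℕ → Set where
  𝟏  : (n : ℕ) → Term n n
  ε  : (n : ℕ) → Term (suc n) n
  χ  : (n : ℕ) → Term (suc (suc n)) (suc (suc n))
  _∘_ : ∀ {n m k} → Term m k → Term n m → Term n k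
  □  : ∀ {n m} → Term n m → Term (suc n) (suc m)

infix 4 _≈_

data _≈_ : ∀ {n m} → Term n m → Term n m → Set where
  ≈-refl  : ∀ {n m} {f : Term n m} → f ≈ f
  ≈-sym   : ∀ {n m} {f g : Term n m} → f ≈ g → g ≈ f
  ≈-trans : ∀ {n m} {f g h : Term n m} → f ≈ g → g ≈ h → f ≈ h
  ∘-cong  : ∀ {n m k} {g g′ : Term m k} {f f′ : Term n m} →
            g ≈ g′ → f ≈ f′ → g ∘ f ≈ g′ ∘ f′
  □-cong  : ∀ {n m} {f f′ : Term n m} → f ≈ f′ → □ f ≈ □ f′
  idʳ     : ∀ {n m} (f : Term n m) → f ∘ 𝟏 n ≈ f
  idˡ     : ∀ {n m} (f : Term n m) → 𝟏 m ∘ f ≈ f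
  assoc   : ∀ {n m k l} (h : Term k l) (g : Term m k) (f : Term n m) →
            h ∘ (g ∘ f) ≈ (h ∘ g) ∘ f
  □-id    : ∀ n → □ (𝟏 n) ≈ 𝟏 (suc n)
  □-∘     : ∀ {n m k} (g : Term m k) (f : Term n m) → □ (g ∘ f) ≈ □ g ∘ □ f
  ε-nat   : ∀ {n m} (f : Term n m) → ε m ∘ □ f ≈ f ∘ ε n
  χ-nat   : ∀ {n m} (f : Term n m) → □ (□ f) ∘ χ n ≈ χ m ∘ □ (□ f)
  χ-inv   : ∀ n → χ n ∘ χ n ≈ 𝟏 (suc (suc n))
  χ-braid : ∀ n → χ (suc n) ∘ □ (χ n) ∘ χ (suc n) ≈ □ (χ n) ∘ χ (suc n) ∘ □ (χ n)
  εχ      : ∀ n → ε (suc n) ∘ χ n ≈ □ (ε n)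

-- Rel: arrows n → m are relations R ⊆ n × m, given by decidable
-- characteristic functions on Fin n × Fin m.
Relation : ℕ → ℕ → Set
Relation n m = Fin n → Fin m → Bool

anyFin : ∀ {m} → (Fin m → Bool) → Bool
anyFin {zero}  p = false
anyFin {suc m} p = p Fin.zero ∨ anyFin (λ j → p (Fin.suc j))

_⊙_ : ∀ {n m k} → Relation m k → Relation n m → Relation n k
(S ⊙ R) i k = anyFin (λ j → R i j ∧ S j k)

_≐_ : ∀ {n m} → Relation n m → Relation n m → Set
R ≐ S = ∀ i j → R i j ≡ S i j

-- down i = just i' if i = inject₁ i', and nothing if i = fromℕ n (the new top element n)
down : ∀ {n} → Fin (suc n) → Maybe (Fin n)
down {zero}  _        = nothing
down {suc n} Fin.zero = just Fin.zero
down {suc n} (Fin.suc i) = Data.Maybe.map Fin.suc (down i)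

-- box R = R ∪ {(n,m)}, viewing R ⊆ n × m inside (n+1) × (m+1)
box : ∀ {n m} → Relation n m → Relation (suc n) (suc m)
box R i j with down i | down j
... | just i′ | just j′ = R i′ j′
... | nothing | nothing = true
... | _       | _       = false

G : ∀ {n m} → Term n m → Relation n m
G (𝟏 n) i j = toℕ i ≡ᵇ toℕ j
G (ε n) i j = toℕ i ≡ᵇ toℕ j          -- {(i,i) : i < n}; empty when n = 0
G (χ n) i j =
  ((toℕ i <ᵇ n) ∧ (toℕ i ≡ᵇ toℕ j))
  ∨ ((toℕ i ≡ᵇ n) ∧ (toℕ j ≡ᵇ suc n))
  ∨ ((toℕ i ≡ᵇ suc n) ∧ (toℕ j ≡ᵇ n))
G (g ∘ f) = G g ⊙ G f
G (□ f) = box (G f)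

-- Send a term f : n ⊢ m to the injection ⟦ f ⟧ : m → n taking each element of the
-- target to the element of the source it comes from.  The equations of S_χ hold for
-- these injections, and G f is exactly the converse of ⟦ f ⟧, so G f = G g forces
-- ⟦ f ⟧ = ⟦ g ⟧.  It remains to see that ⟦ f ⟧ determines f up to ≈.  Every term is
-- provably equal to a normal form  □ x ∘ cycle n d  with x again normal: the top
-- element of the target comes from source position d (counted from the top), and the
-- product of χ's cycle n d moves it there.  Normalising pushes one generator at a time
-- through such a form, the braid relation being what lets χ pass two cycles; distinct
-- normal forms visibly give distinct injections.
module Submission where

open import Data.Bool using (Bool; true; false; T; _∧_)
open import Data.Bool.Properties using (T-∧; T-∨; ∨-identityʳ)
open import Data.Fin using (Fin; zero; suc; toℕ; fromℕ; inject₁; opposite; lift)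
open import Data.Fin.Properties
  using (suc-injective; toℕ-injective; toℕ<n; toℕ-fromℕ; toℕ-inject₁; opposite-involutive; opposite-suc; lift-injective)
open import Data.Maybe using (just; nothing)
open import Data.Nat using (ℕ; zero; suc; _<_; _≡ᵇ_; _<ᵇ_)
open import Data.Nat.Properties
  using (≡ᵇ⇒≡; ≡⇒≡ᵇ; <ᵇ-reflects-<; <⇒≢; >⇒≢; <-asym; n≮n; n<1+n; m<n⇒m<1+n)
open import Data.Product using (∃; ∃₂; ∃-syntax; _,_)
open import Data.Sum using (inj₁; inj₂)
open import Function.Bundles using (_⇔_; mk⇔; module Equivalence)
open import Function.Definitions using (Injective)
open import Level using (0ℓ)
open import Relation.Binary.Bundles using (Setoid)
open import Relation.Binary.PropositionalEquality
open import Relation.Nullary using (¬_)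
open import Relation.Nullary.Reflects using (Reflects; ofʸ; ofⁿ; fromEquivalence; det)
import Relation.Binary.Reasoning.Setoid as SetoidReasoning

open import Defs

open Equivalence using (to; from)

≈-setoid : ℕ → ℕ → Setoid 0ℓ 0ℓ
≈-setoid n m = record
  { Carrier       = Term n m
  ; _≈_           = _≈_
  ; isEquivalence = record { refl = ≈-refl ; sym = ≈-sym ; trans = ≈-trans }
  }

module ≈-Reasoning {n m : ℕ} = SetoidReasoning (≈-setoid n m)
open ≈-Reasoning

infixr 4 _⟩∘⟨_ refl⟩∘⟨_
infixl 5 _⟩∘⟨refl

_⟩∘⟨_ : ∀ {n m k} {g g′ : Term m k} {f f′ : Term n m} → g ≈ g′ → f ≈ f′ → g ∘ f ≈ g′ ∘ f′
_⟩∘⟨_ = ∘-cong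

refl⟩∘⟨_ : ∀ {n m k} {g : Term m k} {f f′ : Term n m} → f ≈ f′ → g ∘ f ≈ g ∘ f′
refl⟩∘⟨_ = ∘-cong ≈-refl

_⟩∘⟨refl : ∀ {n m k} {g g′ : Term m k} {f : Term n m} → g ≈ g′ → g ∘ f ≈ g′ ∘ f
g≈g′ ⟩∘⟨refl = ∘-cong g≈g′ ≈-refl

□ε∘χ : ∀ n → □ (ε n) ∘ χ n ≈ ε (suc n)
□ε∘χ n = begin
  □ (ε n) ∘ χ n             ≈⟨ ≈-sym (εχ n) ⟩∘⟨refl ⟩
  (ε (suc n) ∘ χ n) ∘ χ n   ≈⟨ assoc _ _ _ ⟨
  ε (suc n) ∘ (χ n ∘ χ n)   ≈⟨ refl⟩∘⟨ χ-inv n ⟩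
  ε (suc n) ∘ 𝟏 _           ≈⟨ idʳ _ ⟩
  ε (suc n)                 ∎

χ∘□ε : ∀ n → χ n ∘ □ (ε (suc n)) ≈ □ (□ (ε n)) ∘ (χ (suc n) ∘ □ (χ n))
χ∘□ε n = ≈-trans lhs (≈-sym rhs)
  where
  lhs : χ n ∘ □ (ε (suc n)) ≈ ε (suc (suc n)) ∘ (□ (χ n) ∘ χ (suc n))
  lhs = begin
    χ n ∘ □ (ε (suc n))                        ≈⟨ refl⟩∘⟨ εχ (suc n) ⟨
    χ n ∘ (ε (suc (suc n)) ∘ χ (suc n))        ≈⟨ assoc _ _ _ ⟩
    (χ n ∘ ε (suc (suc n))) ∘ χ (suc n)        ≈⟨ ≈-sym (ε-nat (χ n)) ⟩∘⟨refl ⟩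
    (ε (suc (suc n)) ∘ □ (χ n)) ∘ χ (suc n)    ≈⟨ assoc _ _ _ ⟨
    ε (suc (suc n)) ∘ (□ (χ n) ∘ χ (suc n))    ∎
  rhs : □ (□ (ε n)) ∘ (χ (suc n) ∘ □ (χ n)) ≈ ε (suc (suc n)) ∘ (□ (χ n) ∘ χ (suc n))
  rhs = begin
    □ (□ (ε n)) ∘ (χ (suc n) ∘ □ (χ n))                   ≈⟨ □-cong (≈-sym (εχ n)) ⟩∘⟨refl ⟩
    □ (ε (suc n) ∘ χ n) ∘ (χ (suc n) ∘ □ (χ n))           ≈⟨ □-∘ _ _ ⟩∘⟨refl ⟩
    (□ (ε (suc n)) ∘ □ (χ n)) ∘ (χ (suc n) ∘ □ (χ n))     ≈⟨ assoc _ _ _ ⟨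
    □ (ε (suc n)) ∘ (□ (χ n) ∘ (χ (suc n) ∘ □ (χ n)))     ≈⟨ refl⟩∘⟨ χ-braid n ⟨
    □ (ε (suc n)) ∘ (χ (suc n) ∘ (□ (χ n) ∘ χ (suc n)))   ≈⟨ assoc _ _ _ ⟩
    (□ (ε (suc n)) ∘ χ (suc n)) ∘ (□ (χ n) ∘ χ (suc n))   ≈⟨ □ε∘χ (suc n) ⟩∘⟨refl ⟩
    ε (suc (suc n)) ∘ (□ (χ n) ∘ χ (suc n))               ∎

χ-braid-∘ : ∀ n {k} (h : Term k (suc (suc (suc n)))) →
            χ (suc n) ∘ (□ (χ n) ∘ (χ (suc n) ∘ h)) ≈ □ (χ n) ∘ (χ (suc n) ∘ (□ (χ n) ∘ h))
χ-braid-∘ n h = begin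
  χ (suc n) ∘ (□ (χ n) ∘ (χ (suc n) ∘ h))    ≈⟨ refl⟩∘⟨ assoc _ _ _ ⟩
  χ (suc n) ∘ ((□ (χ n) ∘ χ (suc n)) ∘ h)    ≈⟨ assoc _ _ _ ⟩
  (χ (suc n) ∘ (□ (χ n) ∘ χ (suc n))) ∘ h    ≈⟨ χ-braid n ⟩∘⟨refl ⟩
  (□ (χ n) ∘ (χ (suc n) ∘ □ (χ n))) ∘ h      ≈⟨ assoc _ _ _ ⟨
  □ (χ n) ∘ ((χ (suc n) ∘ □ (χ n)) ∘ h)      ≈⟨ refl⟩∘⟨ assoc _ _ _ ⟨
  □ (χ n) ∘ (χ (suc n) ∘ (□ (χ n) ∘ h))      ∎

χ-slide : ∀ {m n k} (a : Term (suc m) (suc n)) (b : Term k (suc (suc m))) →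
          □ (χ n ∘ □ a) ∘ (χ (suc m) ∘ □ b) ≈ □ (χ n) ∘ (χ (suc n) ∘ □ (□ a ∘ b))
χ-slide {m} {n} a b = begin
  □ (χ n ∘ □ a) ∘ (χ (suc m) ∘ □ b)         ≈⟨ □-∘ _ _ ⟩∘⟨refl ⟩
  (□ (χ n) ∘ □ (□ a)) ∘ (χ (suc m) ∘ □ b)   ≈⟨ assoc _ _ _ ⟨
  □ (χ n) ∘ (□ (□ a) ∘ (χ (suc m) ∘ □ b))   ≈⟨ refl⟩∘⟨ assoc _ _ _ ⟩
  □ (χ n) ∘ ((□ (□ a) ∘ χ (suc m)) ∘ □ b)   ≈⟨ refl⟩∘⟨ χ-nat a ⟩∘⟨refl ⟩
  □ (χ n) ∘ ((χ (suc n) ∘ □ (□ a)) ∘ □ b)   ≈⟨ refl⟩∘⟨ assoc _ _ _ ⟨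
  □ (χ n) ∘ (χ (suc n) ∘ (□ (□ a) ∘ □ b))   ≈⟨ refl⟩∘⟨ refl⟩∘⟨ □-∘ _ _ ⟨
  □ (χ n) ∘ (χ (suc n) ∘ □ (□ a ∘ b))       ∎

-- Normal forms

cycle : ∀ n → Fin (suc n) → Term (suc n) (suc n)
cycle n zero = 𝟏 (suc n)
cycle (suc n) (suc d) = χ n ∘ □ (cycle n d)

εAt : ∀ n → Fin (suc n) → Term (suc n) n
εAt n zero = ε n
εAt (suc n) (suc d) = □ (εAt n d)

discard : ∀ n → Term n 0
discard zero = 𝟏 0
discard (suc n) = discard n ∘ ε n

infixr 5 _∷_

data NF : ℕ → ℕ → Set where
  base : ∀ n → NF n 0
  _∷_  : ∀ {n m} → Fin (suc n) → NF n m → NF (suc n) (suc m)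

embed : ∀ {n m} → NF n m → Term n m
embed (base n) = discard n
embed (_∷_ {n} d x) = □ (embed x) ∘ cycle n d

ε∘cycle : ∀ n d → ε n ∘ cycle n d ≈ εAt n d
ε∘cycle n zero = idʳ (ε n)
ε∘cycle (suc n) (suc d) = begin
  ε (suc n) ∘ (χ n ∘ □ (cycle n d))  ≈⟨ assoc _ _ _ ⟩
  (ε (suc n) ∘ χ n) ∘ □ (cycle n d)  ≈⟨ εχ n ⟩∘⟨refl ⟩
  □ (ε n) ∘ □ (cycle n d)            ≈⟨ □-∘ _ _ ⟨
  □ (ε n ∘ cycle n d)                ≈⟨ □-cong (ε∘cycle n d) ⟩
  □ (εAt n d)                        ∎

discard∘εAt : ∀ n d → discard n ∘ εAt n d ≈ discard (suc n)
discard∘εAt n zero = ≈-refl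
discard∘εAt (suc n) (suc d) = begin
  (discard n ∘ ε n) ∘ □ (εAt n d)    ≈⟨ assoc _ _ _ ⟨
  discard n ∘ (ε n ∘ □ (εAt n d))    ≈⟨ refl⟩∘⟨ ε-nat (εAt n d) ⟩
  discard n ∘ (εAt n d ∘ ε (suc n))  ≈⟨ assoc _ _ _ ⟩
  (discard n ∘ εAt n d) ∘ ε (suc n)  ≈⟨ discard∘εAt n d ⟩∘⟨refl ⟩
  discard (suc n) ∘ ε (suc n)        ∎

cycle∘□εAt : ∀ n (e d : Fin (suc n)) →
             ∃₂ λ e′ d′ → cycle n e ∘ □ (εAt n d) ≈ □ (εAt n d′) ∘ cycle (suc n) e′
cycle∘□εAt n zero d = zero , d , ≈-trans (idˡ _) (≈-sym (idʳ _))
cycle∘□εAt (suc n) (suc e) zero = suc (suc e) , suc zero , (begin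
  (χ n ∘ □ (cycle n e)) ∘ □ (ε (suc n))                    ≈⟨ assoc _ _ _ ⟨
  χ n ∘ (□ (cycle n e) ∘ □ (ε (suc n)))                    ≈⟨ refl⟩∘⟨ □-∘ _ _ ⟨
  χ n ∘ □ (cycle n e ∘ ε (suc n))                          ≈⟨ refl⟩∘⟨ □-cong (ε-nat (cycle n e)) ⟨
  χ n ∘ □ (ε (suc n) ∘ □ (cycle n e))                      ≈⟨ refl⟩∘⟨ □-∘ _ _ ⟩
  χ n ∘ (□ (ε (suc n)) ∘ □ (□ (cycle n e)))                ≈⟨ assoc _ _ _ ⟩
  (χ n ∘ □ (ε (suc n))) ∘ □ (□ (cycle n e))                ≈⟨ χ∘□ε n ⟩∘⟨refl ⟩
  (□ (□ (ε n)) ∘ (χ (suc n) ∘ □ (χ n))) ∘ □ (□ (cycle n e)) ≈⟨ assoc _ _ _ ⟨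
  □ (□ (ε n)) ∘ ((χ (suc n) ∘ □ (χ n)) ∘ □ (□ (cycle n e))) ≈⟨ refl⟩∘⟨ assoc _ _ _ ⟨
  □ (□ (ε n)) ∘ (χ (suc n) ∘ (□ (χ n) ∘ □ (□ (cycle n e)))) ≈⟨ refl⟩∘⟨ refl⟩∘⟨ □-∘ _ _ ⟨
  □ (□ (ε n)) ∘ (χ (suc n) ∘ □ (χ n ∘ □ (cycle n e)))       ∎)
cycle∘□εAt (suc n) (suc e) (suc d) with cycle∘□εAt n e d
... | e′ , d′ , eq = suc e′ , suc d′ , (begin
  (χ n ∘ □ (cycle n e)) ∘ □ (□ (εAt n d))                  ≈⟨ assoc _ _ _ ⟨
  χ n ∘ (□ (cycle n e) ∘ □ (□ (εAt n d)))                  ≈⟨ refl⟩∘⟨ □-∘ _ _ ⟨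
  χ n ∘ □ (cycle n e ∘ □ (εAt n d))                        ≈⟨ refl⟩∘⟨ □-cong eq ⟩
  χ n ∘ □ (□ (εAt n d′) ∘ cycle (suc n) e′)                ≈⟨ refl⟩∘⟨ □-∘ _ _ ⟩
  χ n ∘ (□ (□ (εAt n d′)) ∘ □ (cycle (suc n) e′))          ≈⟨ assoc _ _ _ ⟩
  (χ n ∘ □ (□ (εAt n d′))) ∘ □ (cycle (suc n) e′)          ≈⟨ ≈-sym (χ-nat (εAt n d′)) ⟩∘⟨refl ⟩
  (□ (□ (εAt n d′)) ∘ χ (suc n)) ∘ □ (cycle (suc n) e′)    ≈⟨ assoc _ _ _ ⟨
  □ (□ (εAt n d′)) ∘ (χ (suc n) ∘ □ (cycle (suc n) e′))    ∎)

χ∘□cycle∘cycle : ∀ n (p : Fin (suc (suc n))) (q : Fin (suc n)) →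
                 ∃₂ λ p′ q′ → χ n ∘ (□ (cycle n q) ∘ cycle (suc n) p) ≈ □ (cycle n q′) ∘ cycle (suc n) p′
χ∘□cycle∘cycle n zero q = suc q , zero , (begin
  χ n ∘ (□ (cycle n q) ∘ 𝟏 _)   ≈⟨ refl⟩∘⟨ idʳ _ ⟩
  χ n ∘ □ (cycle n q)           ≈⟨ idˡ _ ⟨
  𝟏 _ ∘ (χ n ∘ □ (cycle n q))   ≈⟨ ≈-sym (□-id _) ⟩∘⟨refl ⟩
  □ (𝟏 _) ∘ (χ n ∘ □ (cycle n q)) ∎)
χ∘□cycle∘cycle n (suc p) zero = zero , p , (begin
  χ n ∘ (□ (𝟏 _) ∘ (χ n ∘ □ (cycle n p)))  ≈⟨ refl⟩∘⟨ □-id _ ⟩∘⟨refl ⟩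
  χ n ∘ (𝟏 _ ∘ (χ n ∘ □ (cycle n p)))      ≈⟨ refl⟩∘⟨ idˡ _ ⟩
  χ n ∘ (χ n ∘ □ (cycle n p))              ≈⟨ assoc _ _ _ ⟩
  (χ n ∘ χ n) ∘ □ (cycle n p)              ≈⟨ χ-inv n ⟩∘⟨refl ⟩
  𝟏 _ ∘ □ (cycle n p)                      ≈⟨ idˡ _ ⟩
  □ (cycle n p)                            ≈⟨ idʳ _ ⟨
  □ (cycle n p) ∘ 𝟏 _                      ∎)
χ∘□cycle∘cycle (suc n) (suc p) (suc q) with χ∘□cycle∘cycle n p q
... | p′ , q′ , eq = suc p′ , suc q′ , (begin
  χ (suc n) ∘ (□ (χ n ∘ □ (cycle n q)) ∘ (χ (suc n) ∘ □ (cycle (suc n) p)))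
    ≈⟨ refl⟩∘⟨ χ-slide (cycle n q) (cycle (suc n) p) ⟩
  χ (suc n) ∘ (□ (χ n) ∘ (χ (suc n) ∘ □ (□ (cycle n q) ∘ cycle (suc n) p)))
    ≈⟨ χ-braid-∘ n _ ⟩
  □ (χ n) ∘ (χ (suc n) ∘ (□ (χ n) ∘ □ (□ (cycle n q) ∘ cycle (suc n) p)))
    ≈⟨ refl⟩∘⟨ refl⟩∘⟨ □-∘ _ _ ⟨
  □ (χ n) ∘ (χ (suc n) ∘ □ (χ n ∘ (□ (cycle n q) ∘ cycle (suc n) p)))
    ≈⟨ refl⟩∘⟨ refl⟩∘⟨ □-cong eq ⟩
  □ (χ n) ∘ (χ (suc n) ∘ □ (□ (cycle n q′) ∘ cycle (suc n) p′))
    ≈⟨ χ-slide (cycle n q′) (cycle (suc n) p′) ⟨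
  □ (χ n ∘ □ (cycle n q′)) ∘ (χ (suc n) ∘ □ (cycle (suc n) p′)) ∎)

embed∘εAt : ∀ {n m} (x : NF n m) (d : Fin (suc n)) → ∃[ y ] embed x ∘ εAt n d ≈ embed y
embed∘εAt (base n) d = base (suc n) , discard∘εAt n d
embed∘εAt (_∷_ {n} e x) zero with embed∘εAt x zero
... | y , eq = suc e ∷ y , (begin
  (□ (embed x) ∘ cycle n e) ∘ ε (suc n)          ≈⟨ assoc _ _ _ ⟨
  □ (embed x) ∘ (cycle n e ∘ ε (suc n))          ≈⟨ refl⟩∘⟨ ε-nat (cycle n e) ⟨
  □ (embed x) ∘ (ε (suc n) ∘ □ (cycle n e))      ≈⟨ refl⟩∘⟨ ≈-sym (□ε∘χ n) ⟩∘⟨refl ⟩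
  □ (embed x) ∘ ((□ (ε n) ∘ χ n) ∘ □ (cycle n e)) ≈⟨ refl⟩∘⟨ assoc _ _ _ ⟨
  □ (embed x) ∘ (□ (ε n) ∘ (χ n ∘ □ (cycle n e))) ≈⟨ assoc _ _ _ ⟩
  (□ (embed x) ∘ □ (ε n)) ∘ (χ n ∘ □ (cycle n e)) ≈⟨ ≈-sym (□-∘ _ _) ⟩∘⟨refl ⟩
  □ (embed x ∘ ε n) ∘ (χ n ∘ □ (cycle n e))      ≈⟨ □-cong eq ⟩∘⟨refl ⟩
  □ (embed y) ∘ (χ n ∘ □ (cycle n e))            ∎)
embed∘εAt (_∷_ {n} e x) (suc d) with cycle∘□εAt n e d
... | e′ , d′ , eq with embed∘εAt x d′
...   | y , eq′ = e′ ∷ y , (begin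
  (□ (embed x) ∘ cycle n e) ∘ □ (εAt n d)        ≈⟨ assoc _ _ _ ⟨
  □ (embed x) ∘ (cycle n e ∘ □ (εAt n d))        ≈⟨ refl⟩∘⟨ eq ⟩
  □ (embed x) ∘ (□ (εAt n d′) ∘ cycle (suc n) e′) ≈⟨ assoc _ _ _ ⟩
  (□ (embed x) ∘ □ (εAt n d′)) ∘ cycle (suc n) e′ ≈⟨ ≈-sym (□-∘ _ _) ⟩∘⟨refl ⟩
  □ (embed x ∘ εAt n d′) ∘ cycle (suc n) e′      ≈⟨ □-cong eq′ ⟩∘⟨refl ⟩
  □ (embed y) ∘ cycle (suc n) e′                 ∎)

∘embed : ∀ {n m k} (f : Term m k) (x : NF n m) → ∃[ y ] f ∘ embed x ≈ embed y
∘embed (𝟏 _) x = x , idˡ _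
∘embed (ε m) (_∷_ {n} d x) with embed∘εAt x d
... | y , eq = y , (begin
  ε m ∘ (□ (embed x) ∘ cycle n d)    ≈⟨ assoc _ _ _ ⟩
  (ε m ∘ □ (embed x)) ∘ cycle n d    ≈⟨ ε-nat _ ⟩∘⟨refl ⟩
  (embed x ∘ ε n) ∘ cycle n d        ≈⟨ assoc _ _ _ ⟨
  embed x ∘ (ε n ∘ cycle n d)        ≈⟨ refl⟩∘⟨ ε∘cycle n d ⟩
  embed x ∘ εAt n d                  ≈⟨ eq ⟩
  embed y                            ∎)
∘embed (χ m) (_∷_ {suc n} p (q ∷ y)) with χ∘□cycle∘cycle n p q
... | p′ , q′ , eq = p′ ∷ q′ ∷ y , (begin
  χ m ∘ (□ (□ (embed y) ∘ cycle n q) ∘ cycle (suc n) p)       ≈⟨ refl⟩∘⟨ □-∘ _ _ ⟩∘⟨refl ⟩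
  χ m ∘ ((□ (□ (embed y)) ∘ □ (cycle n q)) ∘ cycle (suc n) p) ≈⟨ refl⟩∘⟨ assoc _ _ _ ⟨
  χ m ∘ (□ (□ (embed y)) ∘ (□ (cycle n q) ∘ cycle (suc n) p)) ≈⟨ assoc _ _ _ ⟩
  (χ m ∘ □ (□ (embed y))) ∘ (□ (cycle n q) ∘ cycle (suc n) p) ≈⟨ ≈-sym (χ-nat _) ⟩∘⟨refl ⟩
  (□ (□ (embed y)) ∘ χ n) ∘ (□ (cycle n q) ∘ cycle (suc n) p) ≈⟨ assoc _ _ _ ⟨
  □ (□ (embed y)) ∘ (χ n ∘ (□ (cycle n q) ∘ cycle (suc n) p)) ≈⟨ refl⟩∘⟨ eq ⟩
  □ (□ (embed y)) ∘ (□ (cycle n q′) ∘ cycle (suc n) p′)       ≈⟨ assoc _ _ _ ⟩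
  (□ (□ (embed y)) ∘ □ (cycle n q′)) ∘ cycle (suc n) p′       ≈⟨ ≈-sym (□-∘ _ _) ⟩∘⟨refl ⟩
  □ (□ (embed y) ∘ cycle n q′) ∘ cycle (suc n) p′             ∎)
∘embed (g ∘ f) x with ∘embed f x
... | y , eq with ∘embed g y
...   | z , eq′ = z , (begin
  (g ∘ f) ∘ embed x  ≈⟨ assoc _ _ _ ⟨
  g ∘ (f ∘ embed x)  ≈⟨ refl⟩∘⟨ eq ⟩
  g ∘ embed y        ≈⟨ eq′ ⟩
  embed z            ∎)
∘embed (□ f) (_∷_ {n} d x) with ∘embed f x
... | y , eq = d ∷ y , (begin
  □ f ∘ (□ (embed x) ∘ cycle n d)   ≈⟨ assoc _ _ _ ⟩
  (□ f ∘ □ (embed x)) ∘ cycle n d   ≈⟨ ≈-sym (□-∘ _ _) ⟩∘⟨refl ⟩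
  □ (f ∘ embed x) ∘ cycle n d       ≈⟨ □-cong eq ⟩∘⟨refl ⟩
  □ (embed y) ∘ cycle n d           ∎)

𝟏-normal : ∀ n → ∃[ x ] 𝟏 n ≈ embed x
𝟏-normal zero = base zero , ≈-refl
𝟏-normal (suc n) with 𝟏-normal n
... | x , eq = zero ∷ x , (begin
  𝟏 (suc n)           ≈⟨ □-id n ⟨
  □ (𝟏 n)             ≈⟨ □-cong eq ⟩
  □ (embed x)         ≈⟨ idʳ _ ⟨
  □ (embed x) ∘ 𝟏 (suc n) ∎)

normalize : ∀ {n m} (f : Term n m) → ∃[ x ] f ≈ embed x
normalize {n} f with 𝟏-normal n
... | x , eq with ∘embed f x
...   | y , eq′ = y , (begin
  f            ≈⟨ idʳ f ⟨
  f ∘ 𝟏 n      ≈⟨ refl⟩∘⟨ eq ⟩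
  f ∘ embed x  ≈⟨ eq′ ⟩
  embed y      ∎)

-- Terms as injections

swap : ∀ {n} → Fin (suc (suc n)) → Fin (suc (suc n))
swap zero = suc zero
swap (suc zero) = zero
swap (suc (suc i)) = suc (suc i)

-- Elements of an ordinal are numbered from the top (position zero is its largest
-- element; Fin.opposite translates), so that □ adds position zero.  ⟦ f ⟧ sends each
-- target position of f to the source position it comes from.
⟦_⟧ : ∀ {n m} → Term n m → Fin m → Fin n
⟦ 𝟏 n ⟧ j = j
⟦ ε n ⟧ j = suc j
⟦ χ n ⟧ j = swap j
⟦ g ∘ f ⟧ j = ⟦ f ⟧ (⟦ g ⟧ j)
⟦ □ f ⟧ j = lift 1 ⟦ f ⟧ j

⟦⟧-sound : ∀ {n m} {f g : Term n m} → f ≈ g → ⟦ f ⟧ ≗ ⟦ g ⟧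
⟦⟧-sound ≈-refl j = refl
⟦⟧-sound (≈-sym f≈g) j = sym (⟦⟧-sound f≈g j)
⟦⟧-sound (≈-trans f≈g g≈h) j = trans (⟦⟧-sound f≈g j) (⟦⟧-sound g≈h j)
⟦⟧-sound (∘-cong {g′ = g′} {f = f} g≈g′ f≈f′) j =
  trans (cong ⟦ f ⟧ (⟦⟧-sound g≈g′ j)) (⟦⟧-sound f≈f′ (⟦ g′ ⟧ j))
⟦⟧-sound (□-cong f≈f′) zero = refl
⟦⟧-sound (□-cong f≈f′) (suc j) = cong suc (⟦⟧-sound f≈f′ j)
⟦⟧-sound (idʳ f) j = refl
⟦⟧-sound (idˡ f) j = refl
⟦⟧-sound (assoc h g f) j = refl
⟦⟧-sound (□-id n) zero = refl
⟦⟧-sound (□-id n) (suc j) = refl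
⟦⟧-sound (□-∘ g f) zero = refl
⟦⟧-sound (□-∘ g f) (suc j) = refl
⟦⟧-sound (ε-nat f) j = refl
⟦⟧-sound (χ-nat f) zero = refl
⟦⟧-sound (χ-nat f) (suc zero) = refl
⟦⟧-sound (χ-nat f) (suc (suc j)) = refl
⟦⟧-sound (χ-inv n) zero = refl
⟦⟧-sound (χ-inv n) (suc zero) = refl
⟦⟧-sound (χ-inv n) (suc (suc j)) = refl
⟦⟧-sound (χ-braid n) zero = refl
⟦⟧-sound (χ-braid n) (suc zero) = refl
⟦⟧-sound (χ-braid n) (suc (suc zero)) = refl
⟦⟧-sound (χ-braid n) (suc (suc (suc j))) = refl
⟦⟧-sound (εχ n) zero = refl
⟦⟧-sound (εχ n) (suc j) = refl

swap-involutive : ∀ {n} (i : Fin (suc (suc n))) → swap (swap i) ≡ i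
swap-involutive zero = refl
swap-involutive (suc zero) = refl
swap-involutive (suc (suc i)) = refl

⟦⟧-injective : ∀ {n m} (f : Term n m) → Injective _≡_ _≡_ ⟦ f ⟧
⟦⟧-injective (𝟏 n) eq = eq
⟦⟧-injective (ε n) eq = suc-injective eq
⟦⟧-injective (χ n) {i} {j} eq =
  trans (sym (swap-involutive i)) (trans (cong swap eq) (swap-involutive j))
⟦⟧-injective (g ∘ f) eq = ⟦⟧-injective g (⟦⟧-injective f eq)
⟦⟧-injective (□ f) eq = lift-injective ⟦ f ⟧ (⟦⟧-injective f) 1 eq

⟦cycle⟧-zero : ∀ n d → ⟦ cycle n d ⟧ zero ≡ d
⟦cycle⟧-zero n zero = refl
⟦cycle⟧-zero (suc n) (suc d) = cong suc (⟦cycle⟧-zero n d)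

embed-injective : ∀ {n m} (x y : NF n m) → ⟦ embed x ⟧ ≗ ⟦ embed y ⟧ → x ≡ y
embed-injective (base n) (base n) _ = refl
embed-injective (_∷_ {n} d x) (d′ ∷ y) ⟦x⟧≗⟦y⟧
  with trans (sym (⟦cycle⟧-zero n d)) (trans (⟦x⟧≗⟦y⟧ zero) (⟦cycle⟧-zero n d′))
... | refl = cong (d ∷_) (embed-injective x y λ j →
  suc-injective (⟦⟧-injective (cycle n d) (⟦x⟧≗⟦y⟧ (suc j))))

-- G f is the converse of ⟦ f ⟧

≡ᵇ-reflects-≡ : ∀ m n → Reflects (m ≡ n) (m ≡ᵇ n)
≡ᵇ-reflects-≡ m n = fromEquivalence (≡ᵇ⇒≡ m n) (≡⇒≡ᵇ m n)

≡ᵇ-sym : ∀ m n → (m ≡ᵇ n) ≡ (n ≡ᵇ m)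
≡ᵇ-sym m n = det (≡ᵇ-reflects-≡ m n)
  (fromEquivalence (λ h → sym (≡ᵇ⇒≡ n m h)) (λ e → ≡⇒≡ᵇ n m (sym e)))

≡ᵇ-false : ∀ {m n} → m ≢ n → (m ≡ᵇ n) ≡ false
≡ᵇ-false m≢n = det (≡ᵇ-reflects-≡ _ _) (ofⁿ m≢n)

≡ᵇ-refl : ∀ n → (n ≡ᵇ n) ≡ true
≡ᵇ-refl n = det (≡ᵇ-reflects-≡ n n) (ofʸ refl)

<ᵇ-false : ∀ {m n} → ¬ m < n → (m <ᵇ n) ≡ false
<ᵇ-false m≮n = det (<ᵇ-reflects-< _ _) (ofⁿ m≮n)

<ᵇ-true : ∀ {m n} → m < n → (m <ᵇ n) ≡ true
<ᵇ-true m<n = det (<ᵇ-reflects-< _ _) (ofʸ m<n)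

opposite-injective : ∀ {n} {p q : Fin n} → opposite p ≡ opposite q → p ≡ q
opposite-injective {p = p} {q} eq =
  trans (sym (opposite-involutive p)) (trans (cong opposite eq) (opposite-involutive q))

T-toℕ-opposite-≡ᵇ : ∀ {n} (p q : Fin n) → T (toℕ (opposite p) ≡ᵇ toℕ (opposite q)) ⇔ p ≡ q
T-toℕ-opposite-≡ᵇ p q = mk⇔
  (λ h → opposite-injective (toℕ-injective (≡ᵇ⇒≡ _ _ h)))
  (λ p≡q → ≡⇒≡ᵇ _ _ (cong (λ r → toℕ (opposite r)) p≡q))

T-anyFin : ∀ {m} {P : Fin m → Bool} → T (anyFin P) ⇔ ∃ λ k → T (P k)
T-anyFin {zero} = mk⇔ (λ ()) (λ ())
T-anyFin {suc m} {P} = mk⇔ witness intro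
  where
  witness : T (anyFin P) → ∃ λ k → T (P k)
  witness h with to (T-∨ {P zero}) h
  ... | inj₁ h₀ = zero , h₀
  ... | inj₂ h₊ with to T-anyFin h₊
  ...   | k , hk = suc k , hk
  intro : (∃ λ k → T (P k)) → T (anyFin P)
  intro (zero , h) = from (T-∨ {P zero}) (inj₁ h)
  intro (suc k , h) = from (T-∨ {P zero}) (inj₂ (from T-anyFin (k , h)))

down-fromℕ : ∀ n → down (fromℕ n) ≡ nothing
down-fromℕ zero = refl
down-fromℕ (suc n) rewrite down-fromℕ n = refl

down-inject₁ : ∀ {n} (i : Fin n) → down (inject₁ i) ≡ just i
down-inject₁ {suc n} zero = refl
down-inject₁ {suc n} (suc i) rewrite down-inject₁ i = refl

_Represents_ : ∀ {n m} → Relation n m → (Fin m → Fin n) → Set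
R Represents s = ∀ p q → T (R (opposite p) (opposite q)) ⇔ p ≡ s q

Represents-functional : ∀ {n m} {R S : Relation n m} {s t : Fin m → Fin n} →
                        R Represents s → S Represents t → R ≐ S → s ≗ t
Represents-functional {s = s} R∼s S∼t R≐S q =
  to (S∼t (s q) q)
    (subst T (R≐S (opposite (s q)) (opposite q)) (from (R∼s (s q) q) refl))

⊙-Represents : ∀ {n m k} {R : Relation n m} {S : Relation m k}
                 {s : Fin m → Fin n} {t : Fin k → Fin m} →
               R Represents s → S Represents t → (S ⊙ R) Represents (λ l → s (t l))
⊙-Represents {R = R} {S} {s} {t} R∼s S∼t p l = mk⇔ sound complete
  where
  through : ∀ k → T (R (opposite p) (opposite k) ∧ S (opposite k) (opposite l)) → p ≡ s (t l)
  through k h with to (T-∧ {R (opposite p) (opposite k)}) h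
  ... | Rpk , Skl = trans (to (R∼s p k) Rpk) (cong s (to (S∼t k l) Skl))
  sound : T ((S ⊙ R) (opposite p) (opposite l)) → p ≡ s (t l)
  sound h with to T-anyFin h
  ... | k , hk = through (opposite k)
    (subst (λ x → T (R (opposite p) x ∧ S x (opposite l))) (sym (opposite-involutive k)) hk)
  complete : p ≡ s (t l) → T ((S ⊙ R) (opposite p) (opposite l))
  complete p≡stl = from T-anyFin (opposite (t l) ,
    from T-∧ (from (R∼s p (t l)) p≡stl , from (S∼t (t l) l) refl))

box-Represents : ∀ {n m} {R : Relation n m} {s : Fin m → Fin n} →
                 R Represents s → box R Represents lift 1 s
box-Represents {n} {m} R∼s zero zero
  rewrite down-fromℕ n | down-fromℕ m = mk⇔ (λ _ → refl) (λ _ → _)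
box-Represents {n} R∼s zero (suc q)
  rewrite down-fromℕ n | down-inject₁ (opposite q) = mk⇔ (λ ()) (λ ())
box-Represents {m = m} R∼s (suc p) zero
  rewrite down-inject₁ (opposite p) | down-fromℕ m = mk⇔ (λ ()) (λ ())
box-Represents R∼s (suc p) (suc q)
  rewrite down-inject₁ (opposite p) | down-inject₁ (opposite q) =
  mk⇔ (λ h → cong suc (to (R∼s p q) h)) (λ e → from (R∼s p q) (suc-injective e))

G-χ : ∀ n p j → G (χ n) (opposite p) j ≡ (toℕ (opposite (swap p)) ≡ᵇ toℕ j)
G-χ n zero j
  rewrite toℕ-inject₁ (fromℕ n) | toℕ-fromℕ n
        | <ᵇ-false (<-asym (n<1+n n)) | ≡ᵇ-false (>⇒≢ (n<1+n n)) | ≡ᵇ-refl n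
  = ≡ᵇ-sym (toℕ j) n
G-χ n (suc zero) j
  rewrite toℕ-inject₁ (fromℕ n) | toℕ-fromℕ n
        | <ᵇ-false (n≮n n) | ≡ᵇ-refl n | ≡ᵇ-false (<⇒≢ (n<1+n n))
  = trans (∨-identityʳ _) (≡ᵇ-sym (toℕ j) (suc n))
G-χ n (suc (suc k)) j
  rewrite toℕ-inject₁ (inject₁ (opposite k)) | toℕ-inject₁ (opposite k)
        | <ᵇ-true (toℕ<n (opposite k)) | ≡ᵇ-false (<⇒≢ (toℕ<n (opposite k)))
        | ≡ᵇ-false (<⇒≢ (m<n⇒m<1+n (toℕ<n (opposite k))))
  = ∨-identityʳ _

G-Represents : ∀ {n m} (f : Term n m) → G f Represents ⟦ f ⟧
G-Represents (𝟏 n) = T-toℕ-opposite-≡ᵇ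
G-Represents (ε n) p q rewrite sym (opposite-suc q) = T-toℕ-opposite-≡ᵇ p (suc q)
G-Represents (χ n) p q rewrite G-χ n p (opposite q) = mk⇔
  (λ h → trans (sym (swap-involutive p)) (cong swap (to (T-toℕ-opposite-≡ᵇ (swap p) q) h)))
  (λ p≡swap-q → from (T-toℕ-opposite-≡ᵇ (swap p) q) (trans (cong swap p≡swap-q) (swap-involutive q)))
G-Represents (g ∘ f) = ⊙-Represents {R = G f} {S = G g} (G-Represents f) (G-Represents g)
G-Represents (□ f) = box-Represents (G-Represents f)

G-determines-⟦⟧ : ∀ {n m} (f g : Term n m) → G f ≐ G g → ⟦ f ⟧ ≗ ⟦ g ⟧
G-determines-⟦⟧ f g = Represents-functional (G-Represents f) (G-Represents g)

mainTheorem4 : ∀ {n m} (f g : Term n m) → G f ≐ G g → f ≈ g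
mainTheorem4 f g Gf≐Gg with normalize f | normalize g
... | x , f≈x | y , g≈y with embed-injective x y (λ j →
  trans (sym (⟦⟧-sound f≈x j)) (trans (G-determines-⟦⟧ f g Gf≐Gg j) (⟦⟧-sound g≈y j)))
... | refl = ≈-trans f≈x (≈-sym g≈y)
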